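{- Let $G$ and $H$ be graphs. If there are two suitable colourings (for $G$ and $H$) whose indices are coprime, then the system of linear equations $\operatorname{MLIN}(\mathsf P_{\mathrm{iso}}(G,H)^2)$ has a solution over $\mathbb Z$.
   Context: A colouring of the vertices of both graphs $G$ and $H$ (with a common set of colours) is suitable if (1) for every colour, the number of vertices of that colour is the same in $G$ and in $H$; (2) every colour class is an independent set in both graphs; (3) for any two distinct colour classes, the subgraph induced on their union either has no edge or is a matching between the two classes, and this shape (no edges vs. matching) is the same in $G$ and in $H$. The index of a colouring is the product of all the different colour class sizes. A local isomorphism from $G$ to $H$ is an injective map $\pi$ with domain in $V(G)$ and range in $V(H)$ (a subset of $V(G)\times V(H)$) with $vv'\in E(G)\iff\pi(v)\pi(v')\in E(H)$ for $v,v'$ in its domain. Standing assumption: $|V(G)|\ge2$ or $|V(H)|\ge 2$. $\mathsf P_{\mathrm{iso}}(G,H)$ in variables $x_{vw}$: $\sum_{v\in V(G)}x_{vw}-1$ for all $w\in V(H)$; $\sum_{w\in V(H)}x_{vw}-1$ for all $v\in V(G)$; $x_{vw}x_{v'w'}$ whenever $\{(v,w),(v',w')\}$ is not a local isomorphism. For a set $\mathsf P$ of polynomials, $\mathsf P^r$ is the set of polynomials of degree at most $r$ obtained by multiplying a polynomial in $\mathsf P$ by a monomial (including $1$). $\operatorname{MLIN}(\mathsf P)$ replaces each monomial $x_{i_1}\cdots x_{i_\ell}$ by a new variable $X_{\{i_1,\dots,i_\ell\}}$ indexed by the set of variables occurring (constants kept), and sets each resulting linear polynomial equal to $0$. A solution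 over $\mathbb Z$ is an integer assignment satisfying all these equations. -}

module Defs where

open import Level using (0ℓ)
open import Data.Nat using (ℕ; zero; suc; _≤_; _≟_; _⊔_)
open import Data.Fin using (Fin)
import Data.Fin as F
open import Data.List using (List; []; _∷_; map; filter; deduplicate; foldr; length; _++_; allFin)
open import Data.List.Membership.Propositional using (_∈_)
open import Data.Integer using (ℤ; +_; -[1+_]) renaming (_+_ to _+ℤ_; _*_ to _*ℤ_)
open import Data.Product using (Σ; ∃; ∃-syntax; _×_; _,_; proj₁; proj₂)
open import Data.Sum using (_⊎_)
open import Relation.Binary using (Rel; Symmetric; Irreflexive)
open import Relation.Binary.PropositionalEquality using (_≡_; _≢_)
open import Relation.Nullary using (¬_; ¬?)
open import Function using (_∘_)
open import Data.Nat.ListAction using (product)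

record Graph : Set₁ where
  field
    size  : ℕ
    E     : Rel (Fin size) 0ℓ
    sym   : Symmetric E
    irrefl : Irreflexive _≡_ E

open Graph public

V : Graph → Set
V G = Fin (size G)

count : ∀ {n k} → (Fin n → Fin k) → Fin k → ℕ
count {n} col c = length (filter (λ v → col v F.≟ c) (allFin n))

ExactlyOne : ∀ {A : Set} → (A → Set) → Set
ExactlyOne {A} P = Σ A (λ a → P a × (∀ b → P b → b ≡ a))

NoEdges : (G : Graph) {k : ℕ} → (V G → Fin k) → Fin k → Fin k → Set
NoEdges G col c d = ∀ u v → col u ≡ c → col v ≡ d → ¬ E G u v

Matching : (G : Graph) {k : ℕ} → (V G → Fin k) → Fin k → Fin k → Set
Matching G col c d =
  (∀ u → col u ≡ c → ExactlyOne (λ v → col v ≡ d × E G u v)) ×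
  (∀ v → col v ≡ d → ExactlyOne (λ u → col u ≡ c × E G u v))

record Suitable (G H : Graph) (k : ℕ)
                (cG : V G → Fin k) (cH : V H → Fin k) : Set where
  field
    sameCount : ∀ c → count cG c ≡ count cH c
    indepG    : ∀ u v → cG u ≡ cG v → ¬ E G u v
    indepH    : ∀ u v → cH u ≡ cH v → ¬ E H u v
    shape     : ∀ c d → c ≢ d →
                (NoEdges G cG c d × NoEdges H cH c d) ⊎
                (Matching G cG c d × Matching H cH c d)

classSizes : ∀ {n k} → (Fin n → Fin k) → List ℕ
classSizes {k = k} col =
  filter (λ s → ¬? (s ≟ 0)) (map (count col) (allFin k))

index : ∀ {n k} → (Fin n → Fin k) → ℕ
index col = product (deduplicate _≟_ (classSizes col))

Var : Graph → Graph → Set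
Var G H = V G × V H

Mon : Set → Set
Mon X = List X            -- a monomial: product of the listed variables

Poly : Set → Set
Poly X = List (ℤ × Mon X) -- sum of coefficient * monomial

deg : ∀ {X} → Poly X → ℕ
deg p = foldr _⊔_ 0 (map (length ∘ proj₂) p)

_·_ : ∀ {X} → Poly X → Mon X → Poly X
p · μ = map (λ t → proj₁ t , proj₂ t ++ μ) p

IsLocalIso : (G H : Graph) → List (Var G H) → Set
IsLocalIso G H S =
  (∀ {p q} → p ∈ S → q ∈ S → proj₁ p ≡ proj₁ q → proj₂ p ≡ proj₂ q) ×
  (∀ {p q} → p ∈ S → q ∈ S → proj₂ p ≡ proj₂ q → proj₁ p ≡ proj₁ q) ×
  (∀ {p q} → p ∈ S → q ∈ S →
     (E G (proj₁ p) (proj₁ q) → E H (proj₂ p) (proj₂ q)) ×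
     (E H (proj₂ p) (proj₂ q) → E G (proj₁ p) (proj₁ q)))

data Piso (G H : Graph) : Poly (Var G H) → Set where
  sumG : (w : V H) →
    Piso G H (map (λ v → (+ 1 , (v , w) ∷ [])) (allFin (size G)) ++ ((-[1+ 0 ] , []) ∷ []))
  sumH : (v : V G) →
    Piso G H (map (λ w → (+ 1 , (v , w) ∷ [])) (allFin (size H)) ++ ((-[1+ 0 ] , []) ∷ []))
  nonIso : (v v' : V G) (w w' : V H) →
    ¬ IsLocalIso G H ((v , w) ∷ (v' , w') ∷ []) →
    Piso G H ((+ 1 , (v , w) ∷ (v' , w') ∷ []) ∷ [])

_^[_] : ∀ {X} → (Poly X → Set) → ℕ → Poly X → Set
(P ^[ r ]) q = ∃[ p ] ∃[ μ ] (P p × q ≡ p · μ × deg q ≤ r)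

-- an assignment to the MLIN variables X_S, S a (nonempty) set of variables;
-- X is given on lists and must only depend on the set of listed variables
SameSet : ∀ {X : Set} → Mon X → Mon X → Set
SameSet μ ν = ∀ x → (x ∈ μ → x ∈ ν) × (x ∈ ν → x ∈ μ)

SetAssignment : Set → Set
SetAssignment X = Σ (Mon X → ℤ) (λ a → ∀ μ ν → SameSet μ ν → a μ ≡ a ν)

-- value of MLIN of a monomial (constants kept)
mlinMon : ∀ {X} → (Mon X → ℤ) → Mon X → ℤ
mlinMon a []        = + 1
mlinMon a (x ∷ μ)   = a (x ∷ μ)

mlinEval : ∀ {X} → (Mon X → ℤ) → Poly X → ℤ
mlinEval a p = foldr (λ t s → proj₁ t *ℤ mlinMon a (proj₂ t) +ℤ s) (+ 0) p

MLINSolvableℤ : ∀ {X} → (Poly X → Set) → Set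
MLINSolvableℤ {X} P =
  Σ (SetAssignment X) (λ a → ∀ q → P q → mlinEval (proj₁ a) q ≡ + 0)

-- A suitable colouring whose class sizes all divide N (and whose products s s′ of distinct class sizes
-- divide N) gives an integral solution of the equations of MLIN(P_iso(G,H)²) with constant term N instead
-- of 1: inside each colour class of size s one averages, with weight N / s, the s bijections onto the
-- class of the same colour in H that are given by rank v + rank w ≡ t (mod s), and two classes are
-- coupled through their matching, through the common label t when they have the same size, or
-- independently, with weight N / (s s′), otherwise. The index of a colouring is such an N. For two
-- colourings with coprime indices m and n, a Bézout combination a m + b n = 1 of the two solutions solves
-- the system itself.

module Submission where

open import Defs hiding (sym)
open import Level using (Level; 0ℓ)
open import Data.Bool using (Bool; true; false)
open import Data.Nat as ℕ using (ℕ; zero; suc; _<_; _≤_; s≤s; z≤n; NonZero)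
import Data.Nat.Properties as NP
open import Data.Nat.DivMod using (%-distribˡ-+; m%n%n≡m%n; [m+n]%n≡m%n; m<n⇒m%n≡m; m%n≤n; m%n<n; m/n*n≡m)
open import Data.Nat.Divisibility using (_∣_; *-monoʳ-∣; ∣n⇒∣m*n)
open import Data.Nat.Coprimality using (Coprime; coprime-Bézout)
open import Data.Nat.GCD using (module Bézout)
open import Data.Nat.ListAction using (product)
open import Data.Nat.ListAction.Properties using (∈⇒∣product)
open import Data.Fin as F using (Fin; zero; suc)
import Data.Fin.Properties as FP
open import Data.List using (List; []; _∷_; map; filter; length; tabulate; allFin; _++_; deduplicate)
open import Data.List.Properties using (filter-none; map-tabulate)
open import Data.List.Membership.Propositional using (_∈_; find)
open import Data.List.Membership.Propositional.Properties
  using (∈-filter⁺; ∈-filter⁻; ∈-map⁺; ∈-++⁺ˡ; ∈-allFin; ∈-deduplicate⁺)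
open import Data.List.Relation.Unary.Any as Any using (here; there; any?)
import Data.List.Relation.Unary.All as All
open import Data.Product using (Σ; _×_; _,_; proj₁; proj₂)
import Data.Product.Properties as PP
open import Data.Sum using (_⊎_; inj₁; inj₂)
open import Data.Empty using (⊥-elim)
open import Function using (_∘_; flip; case_of_)
open import Relation.Nullary using (Dec; yes; no; ¬_; ¬?)
open import Relation.Nullary.Decidable using (_×-dec_)
open import Relation.Unary using (Pred; Decidable)
open import Relation.Binary using (DecidableEquality; Tri; tri<; tri≈; tri>)
open import Relation.Binary.PropositionalEquality

private
  variable
    n k : ℕ

-- Addition modulo the size of a colour class

module _ where
  open import Data.Nat using (_+_; _∸_; _%_)

  module Modular (d : ℕ) .{{_ : NonZero d}} where

    %-congˡ-+ : ∀ {m m′} o → m % d ≡ m′ % d → (m + o) % d ≡ (m′ + o) % d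
    %-congˡ-+ {m} {m′} o eq = begin
      (m + o) % d             ≡⟨ %-distribˡ-+ m o d ⟩
      (m % d + o % d) % d     ≡⟨ cong (λ r → (r + o % d) % d) eq ⟩
      (m′ % d + o % d) % d    ≡⟨ %-distribˡ-+ m′ o d ⟨
      (m′ + o) % d            ∎
      where open ≡-Reasoning

    +-complement-% : ∀ m b → (m + b + (d ∸ b % d)) % d ≡ m % d
    +-complement-% m b = begin
      (m + b + (d ∸ b % d)) % d       ≡⟨ cong (λ r → (r + (d ∸ b % d)) % d) (NP.+-comm m b) ⟩
      (b + m + (d ∸ b % d)) % d       ≡⟨ %-congˡ-+ (d ∸ b % d) (%-congˡ-+ m (sym (m%n%n≡m%n b d))) ⟩
      (b % d + m + (d ∸ b % d)) % d   ≡⟨ cong (λ r → (r + (d ∸ b % d)) % d) (NP.+-comm (b % d) m) ⟩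
      (m + b % d + (d ∸ b % d)) % d   ≡⟨ cong (_% d) (NP.+-assoc m (b % d) _) ⟩
      (m + (b % d + (d ∸ b % d))) % d ≡⟨ cong (λ r → (m + r) % d) (NP.m+[n∸m]≡n (m%n≤n b d)) ⟩
      (m + d) % d                     ≡⟨ [m+n]%n≡m%n m d ⟩
      m % d                           ∎
      where open ≡-Reasoning

    unshift : ℕ → ℕ → ℕ
    unshift b t = (t + (d ∸ b % d)) % d

    unshift< : ∀ b t → unshift b t < d
    unshift< b t = m%n<n (t + (d ∸ b % d)) d

    unshift-+% : ∀ {a} b → a < d → unshift b ((a + b) % d) ≡ a
    unshift-+% {a} b a<d = begin
      ((a + b) % d + (d ∸ b % d)) % d ≡⟨ %-congˡ-+ (d ∸ b % d) (m%n%n≡m%n (a + b) d) ⟩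
      (a + b + (d ∸ b % d)) % d       ≡⟨ +-complement-% a b ⟩
      a % d                           ≡⟨ m<n⇒m%n≡m a<d ⟩
      a                               ∎
      where open ≡-Reasoning

    +%-unshift : ∀ b {t} → t < d → (unshift b t + b) % d ≡ t
    +%-unshift b {t} t<d = begin
      ((t + (d ∸ b % d)) % d + b) % d ≡⟨ %-congˡ-+ b (m%n%n≡m%n (t + (d ∸ b % d)) d) ⟩
      (t + (d ∸ b % d) + b) % d       ≡⟨ cong (_% d) (NP.+-assoc t (d ∸ b % d) b) ⟩
      (t + ((d ∸ b % d) + b)) % d     ≡⟨ cong (λ r → (t + r) % d) (NP.+-comm (d ∸ b % d) b) ⟩
      (t + (b + (d ∸ b % d))) % d     ≡⟨ cong (_% d) (NP.+-assoc t b _) ⟨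
      (t + b + (d ∸ b % d)) % d       ≡⟨ +-complement-% t b ⟩
      t % d                           ≡⟨ m<n⇒m%n≡m t<d ⟩
      t                               ∎
      where open ≡-Reasoning

  infixl 6 _+[mod_]_

  -- Junk for s = 0 (an empty colour class), where it computes modulo 1.
  _+[mod_]_ : ℕ → ℕ → ℕ → ℕ
  a +[mod s ] b = (a + b) % suc (ℕ.pred s)

  +[mod]-comm : ∀ s a b → a +[mod s ] b ≡ b +[mod s ] a
  +[mod]-comm s a b = cong (_% suc (ℕ.pred s)) (NP.+-comm a b)

  +[mod]-< : ∀ {s} a b → 0 < s → a +[mod s ] b < s
  +[mod]-< {suc s} a b _ = m%n<n (a + b) (suc s)

  +[mod]-cancelʳ : ∀ {s a a′} b → a < s → a′ < s → a +[mod s ] b ≡ a′ +[mod s ] b → a ≡ a′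
  +[mod]-cancelʳ {suc s} {a} {a′} b a<s a′<s eq = begin
    a                               ≡⟨ unshift-+% b a<s ⟨
    unshift b (a +[mod suc s ] b)   ≡⟨ cong (unshift b) eq ⟩
    unshift b (a′ +[mod suc s ] b)  ≡⟨ unshift-+% b a′<s ⟩
    a′                              ∎
    where open ≡-Reasoning
          open Modular (suc s)

  +[mod]-cancelˡ : ∀ {s b b′} a → b < s → b′ < s → a +[mod s ] b ≡ a +[mod s ] b′ → b ≡ b′
  +[mod]-cancelˡ {s} {b} {b′} a b<s b′<s eq =
    +[mod]-cancelʳ a b<s b′<s (trans (+[mod]-comm s b a) (trans eq (+[mod]-comm s a b′)))

  +[mod]-solvableˡ : ∀ {s t} b → t < s → Σ ℕ λ a → a < s × a +[mod s ] b ≡ t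
  +[mod]-solvableˡ {suc s} {t} b t<s = unshift b t , unshift< b t , +%-unshift b t<s
    where open Modular (suc s)

-- Ranks inside colour classes

exactlyOne-map : ∀ {A : Set} {P Q : A → Set} →
                 (∀ a → P a → Q a) → (∀ a → Q a → P a) → ExactlyOne P → ExactlyOne Q
exactlyOne-map P→Q Q→P (a , Pa , unique) = a , P→Q a Pa , λ b → unique b ∘ Q→P b

exactlyOne-sym : ∀ {A B : Set} {P : A → Set} {f g : A → B} →
                 ExactlyOne (λ a → P a × f a ≡ g a) → ExactlyOne (λ a → P a × g a ≡ f a)
exactlyOne-sym = exactlyOne-map (λ _ (p , eq) → p , sym eq) (λ _ (p , eq) → p , sym eq)

exactlyOne-zero : ∀ {P : Fin (suc n) → Set} → P zero → (∀ i → ¬ P (suc i)) → ExactlyOne P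
exactlyOne-zero P0 ¬Psuc = zero , P0 , λ { zero _ → refl ; (suc i) Pi → ⊥-elim (¬Psuc i Pi) }

exactlyOne-suc : ∀ {P : Fin (suc n) → Set} → ¬ P zero → ExactlyOne (P ∘ suc) → ExactlyOne P
exactlyOne-suc ¬P0 (i , Pi , unique) =
  suc i , Pi , λ { zero P0 → ⊥-elim (¬P0 P0) ; (suc j) Pj → cong suc (unique j Pj) }

length-filter-tabulate-∘ : ∀ {A B : Set} {P : Pred B 0ℓ} (P? : Decidable P) (f : A → B) (g : Fin n → A) →
  length (filter P? (tabulate (f ∘ g))) ≡ length (filter (P? ∘ f) (tabulate g))
length-filter-tabulate-∘ {zero}  P? f g = refl
length-filter-tabulate-∘ {suc n} P? f g with P? (f (g zero))
... | yes _ = cong suc (length-filter-tabulate-∘ P? f (g ∘ suc))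
... | no  _ = length-filter-tabulate-∘ P? f (g ∘ suc)

count-here : ∀ (col : Fin (suc n) → Fin k) {c} → col zero ≡ c → count col c ≡ suc (count (col ∘ suc) c)
count-here col {c} col0≡c with col zero F.≟ c
... | yes _ = cong suc (length-filter-tabulate-∘ (λ v → col v F.≟ c) suc (λ v → v))
... | no col0≢c = ⊥-elim (col0≢c col0≡c)

count-there : ∀ (col : Fin (suc n) → Fin k) {c} → col zero ≢ c → count col c ≡ count (col ∘ suc) c
count-there col {c} col0≢c with col zero F.≟ c
... | yes col0≡c = ⊥-elim (col0≢c col0≡c)
... | no _ = length-filter-tabulate-∘ (λ v → col v F.≟ c) suc (λ v → v)

classRank : (Fin n → Fin k) → Fin n → ℕ
classRank col zero = 0
classRank col (suc v) with col zero F.≟ col (suc v)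
... | yes _ = suc (classRank (col ∘ suc) v)
... | no  _ = classRank (col ∘ suc) v

classRank-suc-same : ∀ (col : Fin (suc n) → Fin k) v → col zero ≡ col (suc v) →
                     classRank col (suc v) ≡ suc (classRank (col ∘ suc) v)
classRank-suc-same col v same with col zero F.≟ col (suc v)
... | yes _ = refl
... | no different = ⊥-elim (different same)

classRank-suc-other : ∀ (col : Fin (suc n) → Fin k) v → col zero ≢ col (suc v) →
                      classRank col (suc v) ≡ classRank (col ∘ suc) v
classRank-suc-other col v different with col zero F.≟ col (suc v)
... | yes same = ⊥-elim (different same)
... | no _ = refl

classRank<count : ∀ (col : Fin n → Fin k) v → classRank col v < count col (col v)
classRank<count col zero rewrite count-here col refl = s≤s z≤n
classRank<count col (suc v) = by-cases (col zero F.≟ col (suc v))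
  where
  by-cases : Dec (col zero ≡ col (suc v)) → classRank col (suc v) < count col (col (suc v))
  by-cases (yes same) = subst₂ _<_ (sym (classRank-suc-same col v same)) (sym (count-here col same))
                                (s≤s (classRank<count (col ∘ suc) v))
  by-cases (no other) = subst₂ _<_ (sym (classRank-suc-other col v other)) (sym (count-there col other))
                                (classRank<count (col ∘ suc) v)

classRank-unique : ∀ (col : Fin n → Fin k) c r → r < count col c →
                   ExactlyOne (λ v → col v ≡ c × classRank col v ≡ r)
classRank-unique {suc n} col c r r<count = by-cases (col zero F.≟ c) r r<count
  where
  by-cases : Dec (col zero ≡ c) → ∀ r → r < count col c →
             ExactlyOne (λ v → col v ≡ c × classRank col v ≡ r)
  by-cases (yes col0≡c) zero _ = exactlyOne-zero (col0≡c , refl) λ i (coli≡c , rank≡0) →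
    NP.1+n≢0 (trans (sym (classRank-suc-same col i (trans col0≡c (sym coli≡c)))) rank≡0)
  by-cases (yes col0≡c) (suc r) r<count = exactlyOne-suc (λ { (_ , ()) })
    (exactlyOne-map
      (λ i (coli≡c , rank≡r) → coli≡c , trans (classRank-suc-same col i (trans col0≡c (sym coli≡c))) (cong suc rank≡r))
      (λ i (coli≡c , rank≡1+r) → coli≡c ,
         NP.suc-injective (trans (sym (classRank-suc-same col i (trans col0≡c (sym coli≡c)))) rank≡1+r))
      (classRank-unique (col ∘ suc) c r (NP.≤-pred (subst (suc r <_) (count-here col col0≡c) r<count))))
  by-cases (no col0≢c) r r<count = exactlyOne-suc (col0≢c ∘ proj₁)
    (exactlyOne-map
      (λ i (coli≡c , rank≡r) → coli≡c , trans (classRank-suc-other col i (col0≢c ∘ flip trans coli≡c)) rank≡r)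
      (λ i (coli≡c , rank≡r) → coli≡c , trans (sym (classRank-suc-other col i (col0≢c ∘ flip trans coli≡c))) rank≡r)
      (classRank-unique (col ∘ suc) c r (subst (r <_) (count-there col col0≢c) r<count)))

open import Data.Integer as ℤ using (ℤ; +_; -[1+_]; _+_; _*_; -_)
import Data.Integer.Properties as ℤP
open import Data.Integer.Tactic.RingSolver using (solve-∀)
open import Algebra.Properties.Semiring.Sum ℤP.+-*-semiring using (sum; sum-cong-≗; ∑-distrib-+; ∑-comm; *-distribˡ-sum)

private
  variable
    p q : Level
    P : Set p
    Q : Set q

when : Dec P → ℤ → ℤ
when (yes _) z = z
when (no _)  _ = + 0

when-yes : ∀ (d : Dec P) {z} → P → when d z ≡ z
when-yes (yes _) _  = refl
when-yes (no ¬p) p = ⊥-elim (¬p p)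

when-no : ∀ (d : Dec P) {z} → ¬ P → when d z ≡ + 0
when-no (yes p) ¬p = ⊥-elim (¬p p)
when-no (no _)  _  = refl

when-≡0 : ∀ (d : Dec P) {z} → (P → z ≡ + 0) → when d z ≡ + 0
when-≡0 (yes p) z≡0 = z≡0 p
when-≡0 (no _)  _   = refl

when-cong : ∀ (d : Dec P) (e : Dec Q) {z z′} →
            (P → Q) → (Q → P) → (P → z ≡ z′) → when d z ≡ when e z′
when-cong (yes p) (yes _) _ _ z≡z′ = z≡z′ p
when-cong (yes p) (no ¬q) P→Q _ _ = ⊥-elim (¬q (P→Q p))
when-cong (no ¬p) (yes q) _ Q→P _ = ⊥-elim (¬p (Q→P q))
when-cong (no _)  (no _)  _ _ _   = refl

when-when : ∀ (d : Dec P) (e : Dec Q) {z} → when d (when e z) ≡ when (d ×-dec e) z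
when-when (yes _) (yes _) = refl
when-when (yes _) (no _)  = refl
when-when (no _)  _       = refl

sum-zero : ∀ (f : Fin n → ℤ) → (∀ i → f i ≡ + 0) → sum f ≡ + 0
sum-zero {zero}  f f≡0 = refl
sum-zero {suc n} f f≡0 = cong₂ _+_ (f≡0 zero) (sum-zero (f ∘ suc) (f≡0 ∘ suc))

sum-single : ∀ (f : Fin n → ℤ) j → (∀ i → i ≢ j → f i ≡ + 0) → sum f ≡ f j
sum-single {suc n} f zero f≡0 =
  trans (cong (λ s → f zero + s) (sum-zero (f ∘ suc) (λ i → f≡0 (suc i) λ ())))
        (ℤP.+-identityʳ (f zero))
sum-single {suc n} f (suc j) f≡0 =
  trans (cong (_+ sum (f ∘ suc)) (f≡0 zero λ ()))
        (trans (ℤP.+-identityˡ _)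
               (sum-single (f ∘ suc) j λ i i≢j → f≡0 (suc i) (i≢j ∘ FP.suc-injective)))

sum-unique : ∀ {P : Fin n → Set} (f : Fin n → ℤ) {z} → ExactlyOne P →
             (∀ i → P i → f i ≡ z) → (∀ i → ¬ P i → f i ≡ + 0) → sum f ≡ z
sum-unique f (j , Pj , unique) f≡z f≡0 =
  trans (sum-single f j λ i i≢j → f≡0 i (i≢j ∘ unique i)) (f≡z j Pj)

sum-when-unique : ∀ {P : Fin n → Set} (P? : ∀ i → Dec (P i)) {z} →
                  ExactlyOne P → sum (λ i → when (P? i) z) ≡ z
sum-when-unique P? uniq = sum-unique _ uniq (λ i → when-yes (P? i)) (λ i → when-no (P? i))

sum-when-tabulate : ∀ {A : Set} {P : Pred A 0ℓ} (P? : Decidable P) (g : Fin n → A) z →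
  sum (λ i → when (P? (g i)) z) ≡ z * + length (filter P? (tabulate g))
sum-when-tabulate {zero}  P? g z = sym (ℤP.*-zeroʳ z)
sum-when-tabulate {suc n} P? g z with P? (g zero)
... | yes _ = begin
  z + sum (λ i → when (P? (g (suc i))) z)         ≡⟨ cong (λ s → z + s) (sum-when-tabulate P? (g ∘ suc) z) ⟩
  z + z * + length (filter P? (tabulate (g ∘ suc))) ≡⟨ sym (ℤP.*-suc z _) ⟩
  z * + suc (length (filter P? (tabulate (g ∘ suc)))) ∎
  where open ≡-Reasoning
... | no _ = trans (ℤP.+-identityˡ _) (sum-when-tabulate P? (g ∘ suc) z)

sum-nonzero⇒inhabited : ∀ (f : Fin n → ℤ) → sum f ≢ + 0 → Fin n
sum-nonzero⇒inhabited {zero}  _ sum≢0 = ⊥-elim (sum≢0 refl)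
sum-nonzero⇒inhabited {suc n} _ _     = zero

-- Monomials as sets of variables

module SymmetricAssignment {X : Set} (_≟_ : DecidableEquality X)
                           (y : X → X → ℤ) (y-sym : ∀ p q → y p q ≡ y q p) where

  others : X → List X → List X
  others p = filter (λ z → ¬? (z ≟ p))

  ∈-others : ∀ {z h : X} {r} → z ∈ h ∷ r → z ≢ h → z ∈ others h r
  ∈-others (here z≡h)          z≢h = ⊥-elim (z≢h z≡h)
  ∈-others {h = h} (there z∈r) z≢h = ∈-filter⁺ (λ z → ¬? (z ≟ h)) z∈r z≢h

  others-[] : ∀ {p μ} → (∀ {z} → z ∈ μ → z ≡ p) → others p μ ≡ []
  others-[] {p} all≡p = filter-none (λ z → ¬? (z ≟ p)) (All.tabulate λ z∈μ z≢p → z≢p (all≡p z∈μ))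

  pairValue : X → X → List X → ℤ
  pairValue p q []      = y p q
  pairValue p q (_ ∷ _) = + 0

  value : X → List X → ℤ
  value p []      = y p p
  value p (q ∷ ν) = pairValue p q (others q ν)

  -- y p q on a monomial whose variables are exactly p and q (p = q allowed), 0 on one with three variables.
  assign : List X → ℤ
  assign []      = + 0
  assign (p ∷ μ) = value p (others p μ)

  value-const : ∀ {p q L} → q ∈ L → (∀ {z} → z ∈ L → z ≡ q) → value p L ≡ y p q
  value-const {L = q′ ∷ ν} _ all≡q with all≡q (here refl)
  ... | refl rewrite others-[] {q′} {ν} (all≡q ∘ there) = refl

  pairValue-∷ : ∀ {p q z L} → z ∈ L → pairValue p q L ≡ + 0
  pairValue-∷ (here _)  = refl
  pairValue-∷ (there _) = refl

  value-two : ∀ {p e f L} → e ∈ L → f ∈ L → e ≢ f → value p L ≡ + 0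
  value-two {e = e} {f} {q ∷ ν} e∈L f∈L e≢f with e ≟ q
  ... | yes refl = pairValue-∷ (∈-others f∈L (e≢f ∘ sym))
  ... | no e≢q   = pairValue-∷ (∈-others e∈L e≢q)

  data Support (μ : List X) : Set where
    one   : ∀ p → p ∈ μ → (∀ {z} → z ∈ μ → z ≡ p) → Support μ
    two   : ∀ p q → p ∈ μ → q ∈ μ → p ≢ q → (∀ {z} → z ∈ μ → z ≡ p ⊎ z ≡ q) → Support μ
    three : ∀ a b c → a ∈ μ → b ∈ μ → c ∈ μ → a ≢ b → a ≢ c → b ≢ c → Support μ

  supportValue : ∀ {μ} → Support μ → ℤ
  supportValue (one p _ _)               = y p p
  supportValue (two p q _ _ _ _)         = y p q
  supportValue (three _ _ _ _ _ _ _ _ _) = + 0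

  support-transport : ∀ {μ ν} → (∀ {z} → z ∈ μ → z ∈ ν) → (∀ {z} → z ∈ ν → z ∈ μ) →
                      (s : Support μ) → Σ (Support ν) λ s′ → supportValue s′ ≡ supportValue s
  support-transport μ⊆ν ν⊆μ (one p p∈ all≡p) = one p (μ⊆ν p∈) (all≡p ∘ ν⊆μ) , refl
  support-transport μ⊆ν ν⊆μ (two p q p∈ q∈ p≢q in-pq) = two p q (μ⊆ν p∈) (μ⊆ν q∈) p≢q (in-pq ∘ ν⊆μ) , refl
  support-transport μ⊆ν ν⊆μ (three a b c a∈ b∈ c∈ a≢b a≢c b≢c) =
    three a b c (μ⊆ν a∈) (μ⊆ν b∈) (μ⊆ν c∈) a≢b a≢c b≢c , refl

  assign-support : ∀ {μ} (s : Support μ) → assign μ ≡ supportValue s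
  assign-support {h ∷ r} (one p p∈ all≡p) with all≡p (here refl)
  ... | refl rewrite others-[] {h} {r} (all≡p ∘ there) = refl
  assign-support {h ∷ r} (two p q p∈ q∈ p≢q in-pq) with in-pq (here refl)
  ... | inj₁ refl = value-const (∈-others q∈ (p≢q ∘ sym)) only-q
    where
    only-q : ∀ {z} → z ∈ others h r → z ≡ q
    only-q z∈ with ∈-filter⁻ (λ z → ¬? (z ≟ h)) z∈
    ... | z∈r , z≢h with in-pq (there z∈r)
    ...   | inj₁ z≡h = ⊥-elim (z≢h z≡h)
    ...   | inj₂ z≡q = z≡q
  ... | inj₂ refl = trans (value-const (∈-others p∈ p≢q) only-p) (y-sym h p)
    where
    only-p : ∀ {z} → z ∈ others h r → z ≡ p
    only-p z∈ with ∈-filter⁻ (λ z → ¬? (z ≟ h)) z∈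
    ... | z∈r , z≢h with in-pq (there z∈r)
    ...   | inj₁ z≡p = z≡p
    ...   | inj₂ z≡h = ⊥-elim (z≢h z≡h)
  assign-support {h ∷ r} (three a b c a∈ b∈ c∈ a≢b a≢c b≢c) with a ≟ h | b ≟ h
  ... | yes refl | _ = value-two (∈-others b∈ (a≢b ∘ sym)) (∈-others c∈ (a≢c ∘ sym)) b≢c
  ... | no a≢h | yes refl = value-two (∈-others a∈ a≢h) (∈-others c∈ (b≢c ∘ sym)) a≢c
  ... | no a≢h | no b≢h = value-two (∈-others a∈ a≢h) (∈-others b∈ b≢h) a≢b

  support : ∀ h r → Support (h ∷ r)
  support h r with any? (λ z → ¬? (z ≟ h)) r
  ... | no none = one h (here refl) all≡h
    where
    all≡h : ∀ {z} → z ∈ h ∷ r → z ≡ h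
    all≡h (here z≡h) = z≡h
    all≡h {z} (there z∈r) with z ≟ h
    ... | yes z≡h = z≡h
    ... | no z≢h  = ⊥-elim (none (Any.map (λ { refl → z≢h }) z∈r))
  ... | yes some with find some
  ... | e , e∈r , e≢h with any? (λ z → ¬? (z ≟ h) ×-dec ¬? (z ≟ e)) r
  ...   | yes some′ with find some′
  ...     | f , f∈r , f≢h , f≢e =
    three h e f (here refl) (there e∈r) (there f∈r) (e≢h ∘ sym) (f≢h ∘ sym) (f≢e ∘ sym)
  support h r | yes _ | e , e∈r , e≢h | no none′ = two h e (here refl) (there e∈r) (e≢h ∘ sym) in-he
    where
    in-he : ∀ {z} → z ∈ h ∷ r → z ≡ h ⊎ z ≡ e
    in-he (here z≡h) = inj₁ z≡h
    in-he {z} (there z∈r) with z ≟ h | z ≟ e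
    ... | yes z≡h | _       = inj₁ z≡h
    ... | no _    | yes z≡e = inj₂ z≡e
    ... | no z≢h  | no z≢e  = ⊥-elim (none′ (Any.map (λ { refl → z≢h , z≢e }) z∈r))

  assign-SameSet : ∀ μ ν → SameSet μ ν → assign μ ≡ assign ν
  assign-SameSet []      []      _ = refl
  assign-SameSet []      (h ∷ ν) μ≈ν with () ← proj₂ (μ≈ν h) (here refl)
  assign-SameSet (h ∷ μ) []      μ≈ν with () ← proj₁ (μ≈ν h) (here refl)
  assign-SameSet (h ∷ μ) (h′ ∷ ν) μ≈ν
    with s′ , same-value ← support-transport (proj₁ (μ≈ν _)) (proj₂ (μ≈ν _)) (support h μ) =
    trans (assign-support (support h μ)) (trans (sym same-value) (sym (assign-support s′)))

  setAssignment : SetAssignment X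
  setAssignment = assign , assign-SameSet

  assign-pair : ∀ p q → assign (p ∷ q ∷ []) ≡ y p q
  assign-pair p q with q ≟ p
  ... | yes refl = refl
  ... | no _     = refl

-- x p and y p q are the values of the MLIN variables X_{p} and X_{p,q}; the fields are the equations
-- of MLIN(P_iso(G,H)²), with the constant term of the linear equations multiplied by t.
record QuadraticSolution (G H : Graph) (t : ℤ) : Set where
  field
    x       : Var G H → ℤ
    y       : Var G H → Var G H → ℤ
    y-sym   : ∀ p q → y p q ≡ y q p
    y-diag  : ∀ p → y p p ≡ x p
    x-sumᴳ  : ∀ w → sum (λ v → x (v , w)) ≡ t
    x-sumᴴ  : ∀ v → sum (λ w → x (v , w)) ≡ t
    y-sumᴳ  : ∀ w q → sum (λ v → y (v , w) q) ≡ x q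
    y-sumᴴ  : ∀ v q → sum (λ w → y (v , w) q) ≡ x q
    y-nonIso : ∀ p q → ¬ IsLocalIso G H (p ∷ q ∷ []) → y p q ≡ + 0

private
  sum-lincomb : ∀ {n} α β (f g : Fin n → ℤ) {a b} → sum f ≡ a → sum g ≡ b →
                sum (λ i → α * f i + β * g i) ≡ α * a + β * b
  sum-lincomb α β f g refl refl = begin
    sum (λ i → α * f i + β * g i)                 ≡⟨ ∑-distrib-+ (λ i → α * f i) (λ i → β * g i) ⟩
    sum (λ i → α * f i) + sum (λ i → β * g i)     ≡⟨ cong₂ _+_ (*-distribˡ-sum α f) (*-distribˡ-sum β g) ⟨
    α * sum f + β * sum g                         ∎
    where open ≡-Reasoning

lincomb : ∀ {G H t₁ t₂} → QuadraticSolution G H t₁ → QuadraticSolution G H t₂ →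
          (α β : ℤ) → QuadraticSolution G H (α * t₁ + β * t₂)
lincomb S₁ S₂ α β = record
  { x        = λ p → α * S₁.x p + β * S₂.x p
  ; y        = λ p q → α * S₁.y p q + β * S₂.y p q
  ; y-sym    = λ p q → cong₂ combine (S₁.y-sym p q) (S₂.y-sym p q)
  ; y-diag   = λ p → cong₂ combine (S₁.y-diag p) (S₂.y-diag p)
  ; x-sumᴳ   = λ w → sum-lincomb α β (λ v → S₁.x (v , w)) (λ v → S₂.x (v , w)) (S₁.x-sumᴳ w) (S₂.x-sumᴳ w)
  ; x-sumᴴ   = λ v → sum-lincomb α β (λ w → S₁.x (v , w)) (λ w → S₂.x (v , w)) (S₁.x-sumᴴ v) (S₂.x-sumᴴ v)
  ; y-sumᴳ   = λ w q → sum-lincomb α β (λ v → S₁.y (v , w) q) (λ v → S₂.y (v , w) q) (S₁.y-sumᴳ w q) (S₂.y-sumᴳ w q)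
  ; y-sumᴴ   = λ v q → sum-lincomb α β (λ w → S₁.y (v , w) q) (λ w → S₂.y (v , w) q) (S₁.y-sumᴴ v q) (S₂.y-sumᴴ v q)
  ; y-nonIso = λ p q ¬iso → trans (cong₂ combine (S₁.y-nonIso p q ¬iso) (S₂.y-nonIso p q ¬iso))
                                  (cong₂ _+_ (ℤP.*-zeroʳ α) (ℤP.*-zeroʳ β))
  }
  where
  module S₁ = QuadraticSolution S₁
  module S₂ = QuadraticSolution S₂
  combine : ℤ → ℤ → ℤ
  combine a b = α * a + β * b

mlinEval-tabulate-· : ∀ {X n} (a : Mon X → ℤ) (t : Fin n → ℤ × Mon X) (r : Poly X) μ →
  mlinEval a ((tabulate t ++ r) · μ) ≡
  sum (λ i → proj₁ (t i) * mlinMon a (proj₂ (t i) ++ μ)) + mlinEval a (r · μ)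
mlinEval-tabulate-· {n = zero}  a t r μ = sym (ℤP.+-identityˡ _)
mlinEval-tabulate-· {n = suc n} a t r μ =
  trans (cong (λ s → first + s) (mlinEval-tabulate-· a (t ∘ suc) r μ)) (sym (ℤP.+-assoc first _ _))
  where first = proj₁ (t zero) * mlinMon a (proj₂ (t zero) ++ μ)

deg-∈ : ∀ {X} {t : ℤ × Mon X} {p : Poly X} → t ∈ p → length (proj₂ t) ≤ deg p
deg-∈ {t = t} {p = _ ∷ p} (here refl) = NP.m≤m⊔n (length (proj₂ t)) (deg p)
deg-∈ {p = u ∷ p} (there t∈p)          = NP.≤-trans (deg-∈ t∈p) (NP.m≤n⊔m (length (proj₂ u)) (deg p))

-- The polynomials sumG w and sumH v of P_iso are the rowPoly of a column and of a row.
rowPoly : ∀ {X n} → (Fin n → X) → Poly X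
rowPoly {n = n} e = map (λ i → (+ 1 , e i ∷ [])) (allFin n) ++ ((-[1+ 0 ] , []) ∷ [])

module _ {G H : Graph} (S : QuadraticSolution G H (+ 1)) where
  open QuadraticSolution S
  open SymmetricAssignment (PP.≡-dec F._≟_ F._≟_) y y-sym

  private
    mlinEval-rowPoly : ∀ {n} (e : Fin n → Var G H) μ →
      mlinEval assign (rowPoly e · μ) ≡ sum (λ i → + 1 * assign (e i ∷ μ)) + (-[1+ 0 ] * mlinMon assign μ + + 0)
    mlinEval-rowPoly {n} e μ =
      trans (cong (λ l → mlinEval assign ((l ++ _) · μ)) (map-tabulate (λ i → i) (λ i → (+ 1 , e i ∷ []))))
            (mlinEval-tabulate-· assign (λ i → + 1 , e i ∷ []) _ μ)

    z-z≡0 : ∀ z → z + (-[1+ 0 ] * z + + 0) ≡ + 0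
    z-z≡0 = solve-∀

  module _ {n} (e : Fin n → Var G H) (x-sum : sum (x ∘ e) ≡ + 1)
           (y-sum : ∀ q → sum (λ i → y (e i) q) ≡ x q) where

    sum-assign-row : ∀ μ → length μ ≤ 1 → sum (λ i → assign (e i ∷ μ)) ≡ mlinMon assign μ
    sum-assign-row [] _ = trans (sum-cong-≗ (y-diag ∘ e)) x-sum
    sum-assign-row (q ∷ []) _ = trans (sum-cong-≗ (λ i → assign-pair (e i) q)) (trans (y-sum q) (sym (y-diag q)))
    sum-assign-row (_ ∷ _ ∷ _) (s≤s ())

    nonempty : Fin n
    nonempty = sum-nonzero⇒inhabited (x ∘ e) λ sum≡0 → case trans (sym x-sum) sum≡0 of λ ()

    row-equation : ∀ μ → deg (rowPoly e · μ) ≤ 2 → mlinEval assign (rowPoly e · μ) ≡ + 0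
    row-equation μ deg≤2 = begin
      mlinEval assign (rowPoly e · μ)                                           ≡⟨ mlinEval-rowPoly e μ ⟩
      sum (λ i → + 1 * assign (e i ∷ μ)) + (-[1+ 0 ] * mlinMon assign μ + + 0) ≡⟨ cong (λ s → s + _) sum-μ ⟩
      mlinMon assign μ + (-[1+ 0 ] * mlinMon assign μ + + 0)                   ≡⟨ z-z≡0 (mlinMon assign μ) ⟩
      + 0 ∎
      where
      open ≡-Reasoning
      μ-short : length μ ≤ 1
      μ-short = NP.≤-pred (NP.≤-trans (deg-∈ (∈-map⁺ _ (∈-++⁺ˡ (∈-map⁺ _ (∈-allFin nonempty))))) deg≤2)
      sum-μ : sum (λ i → + 1 * assign (e i ∷ μ)) ≡ mlinMon assign μ
      sum-μ = trans (sum-cong-≗ (λ i → ℤP.*-identityˡ (assign (e i ∷ μ)))) (sum-assign-row μ μ-short)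

  mlinSolvable : MLINSolvableℤ (Piso G H ^[ 2 ])
  mlinSolvable = setAssignment , solves
    where
    solves : ∀ q → (Piso G H ^[ 2 ]) q → mlinEval assign q ≡ + 0
    solves _ (_ , μ , sumG w , refl , deg≤2) = row-equation (λ v → v , w) (x-sumᴳ w) (y-sumᴳ w) μ deg≤2
    solves _ (_ , μ , sumH v , refl , deg≤2) = row-equation (λ w → v , w) (x-sumᴴ v) (y-sumᴴ v) μ deg≤2
    solves _ (_ , [] , nonIso v v′ w w′ ¬iso , refl , _) =
      trans (ℤP.+-identityʳ _) (trans (ℤP.*-identityˡ _)
            (trans (assign-pair (v , w) (v′ , w′)) (y-nonIso _ _ ¬iso)))
    solves _ (_ , _ ∷ _ , nonIso _ _ _ _ _ , refl , s≤s (s≤s ()))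

pair-isLocalIso : ∀ (G H : Graph) {v v′ : V G} {w w′ : V H} →
  (v ≡ v′ → w ≡ w′) → (w ≡ w′ → v ≡ v′) → (E G v v′ → E H w w′) → (E H w w′ → E G v v′) →
  IsLocalIso G H ((v , w) ∷ (v′ , w′) ∷ [])
pair-isLocalIso G H {v} {v′} {w} {w′} v≡→w≡ w≡→v≡ Ev→Ew Ew→Ev = functional , injective , edges
  where
  S : List (Var G H)
  S = (v , w) ∷ (v′ , w′) ∷ []
  endpoints : ∀ {p} → p ∈ S → p ≡ (v , w) ⊎ p ≡ (v′ , w′)
  endpoints (here p≡)          = inj₁ p≡
  endpoints (there (here p≡))  = inj₂ p≡
  endpoints (there (there ()))
  functional : ∀ {p q} → p ∈ S → q ∈ S → proj₁ p ≡ proj₁ q → proj₂ p ≡ proj₂ q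
  functional p∈ q∈ with endpoints p∈ | endpoints q∈
  ... | inj₁ refl | inj₁ refl = λ _ → refl
  ... | inj₁ refl | inj₂ refl = v≡→w≡
  ... | inj₂ refl | inj₁ refl = sym ∘ v≡→w≡ ∘ sym
  ... | inj₂ refl | inj₂ refl = λ _ → refl
  injective : ∀ {p q} → p ∈ S → q ∈ S → proj₂ p ≡ proj₂ q → proj₁ p ≡ proj₁ q
  injective p∈ q∈ with endpoints p∈ | endpoints q∈
  ... | inj₁ refl | inj₁ refl = λ _ → refl
  ... | inj₁ refl | inj₂ refl = w≡→v≡
  ... | inj₂ refl | inj₁ refl = sym ∘ w≡→v≡ ∘ sym
  ... | inj₂ refl | inj₂ refl = λ _ → refl
  edges : ∀ {p q} → p ∈ S → q ∈ S →
          (E G (proj₁ p) (proj₁ q) → E H (proj₂ p) (proj₂ q)) × (E H (proj₂ p) (proj₂ q) → E G (proj₁ p) (proj₁ q))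
  edges p∈ q∈ with endpoints p∈ | endpoints q∈
  ... | inj₁ refl | inj₁ refl = ⊥-elim ∘ irrefl G refl , ⊥-elim ∘ irrefl H refl
  ... | inj₁ refl | inj₂ refl = Ev→Ew , Ew→Ev
  ... | inj₂ refl | inj₁ refl = Graph.sym H ∘ Ev→Ew ∘ Graph.sym G , Graph.sym G ∘ Ew→Ev ∘ Graph.sym H
  ... | inj₂ refl | inj₂ refl = ⊥-elim ∘ irrefl G refl , ⊥-elim ∘ irrefl H refl

isLocalIso-swap : ∀ G H {p q} → IsLocalIso G H (q ∷ p ∷ []) → IsLocalIso G H (p ∷ q ∷ [])
isLocalIso-swap G H {p} {q} (functional , injective , edges) =
  (λ p∈ q∈ → functional (swap p∈) (swap q∈)) , (λ p∈ q∈ → injective (swap p∈) (swap q∈)) ,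
  (λ p∈ q∈ → edges (swap p∈) (swap q∈))
  where
  swap : ∀ {z} → z ∈ p ∷ q ∷ [] → z ∈ q ∷ p ∷ []
  swap (here z≡p)         = there (here z≡p)
  swap (there (here z≡q)) = here z≡q

-- The solution attached to a suitable colouring

module Construction
  (k : ℕ) (classSize : Fin k → ℕ) (matched : Fin k → Fin k → Bool)
  (matched-size : ∀ {c d} → matched c d ≡ true → classSize c ≡ classSize d)
  (N : ℕ)
  (size∣N : ∀ c → classSize c ≢ 0 → classSize c ∣ N)
  (size*size∣N : ∀ c d → classSize c ≢ 0 → classSize d ≢ 0 → classSize c ≢ classSize d →
                 classSize c ℕ.* classSize d ∣ N)
  where

  -- N / m, with junk value N for m = 0
  share : ℕ → ℤ
  share m = + (N ℕ./ suc (ℕ.pred m))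

  share-* : ∀ {m} → m ≢ 0 → m ∣ N → share m * + m ≡ + N
  share-* {zero}  m≢0 _   = ⊥-elim (m≢0 refl)
  share-* {suc m} _   m∣N = trans (sym (ℤP.pos-* (N ℕ./ suc m) (suc m))) (cong +_ (m/n*n≡m m∣N))

  share-cancel : ∀ {a b} → a ≢ 0 → b ≢ 0 → a ℕ.* b ∣ N → b ∣ N → share (a ℕ.* b) * + a ≡ share b
  share-cancel {a@(suc _)} {b@(suc _)} _ _ ab∣N b∣N = ℤP.*-cancelʳ-≡ _ _ (+ b) (begin
    share (a ℕ.* b) * + a * + b     ≡⟨ ℤP.*-assoc (share (a ℕ.* b)) (+ a) (+ b) ⟩
    share (a ℕ.* b) * (+ a * + b)   ≡⟨ cong (share (a ℕ.* b) *_) (ℤP.pos-* a b) ⟨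
    share (a ℕ.* b) * + (a ℕ.* b)   ≡⟨ share-* (λ ()) ab∣N ⟩
    + N                             ≡⟨ share-* (λ ()) b∣N ⟨
    share b * + b                   ∎)
    where open ≡-Reasoning
  share-cancel {zero}      a≢0 _ = ⊥-elim (a≢0 refl)
  share-cancel {b = zero} _ b≢0 = ⊥-elim (b≢0 refl)

  weight : Fin k → ℤ
  weight c = share (classSize c)

  weight₂ : Fin k → Fin k → ℤ
  weight₂ c d = share (classSize c ℕ.* classSize d)

  label : Fin k → ℕ → ℕ → ℕ
  label c a b = a +[mod classSize c ] b

  record Side (Γ : Graph) : Set where
    field
      col               : V Γ → Fin k
      rank              : V Γ → ℕ
      partner           : Fin k → V Γ → V Γ
      count-col         : ∀ c → count col c ≡ classSize c
      rank<             : ∀ v → rank v < classSize (col v)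
      rank-unique       : ∀ c r → r < classSize c → ExactlyOne (λ v → col v ≡ c × rank v ≡ r)
      independent       : ∀ u v → col u ≡ col v → ¬ E Γ u v
      unmatched-noEdges : ∀ {c d} → c F.< d → matched c d ≡ false → NoEdges Γ col c d
      partner-col       : ∀ {c d v} → matched c d ≡ true → col v ≡ d → col (partner c v) ≡ c
      partner-unique    : ∀ {c d u} → matched c d ≡ true → col u ≡ c →
                          ExactlyOne (λ v → col v ≡ d × partner c v ≡ u)
      partner-edge      : ∀ {c d v} → matched c d ≡ true → col v ≡ d → E Γ (partner c v) v
      edge-partner      : ∀ {c d u v} → matched c d ≡ true → col u ≡ c → col v ≡ d → E Γ u v → u ≡ partner c v

    sum-class : ∀ c z → sum (λ v → when (col v F.≟ c) z) ≡ z * + classSize c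
    sum-class c z = trans (sum-when-tabulate (λ v → col v F.≟ c) (λ v → v) z) (cong (λ m → z * + m) (count-col c))

    classSize-nonzero : ∀ v → classSize (col v) ≢ 0
    classSize-nonzero v s≡0 = NP.n≮0 (subst (rank v <_) s≡0 (rank< v))

    classSize-pos : ∀ v → 0 < classSize (col v)
    classSize-pos v = NP.n≢0⇒n>0 (classSize-nonzero v)

    rank<-of : ∀ {v c} → col v ≡ c → rank v < classSize c
    rank<-of refl = rank< _

    rank-injective : ∀ {u u′} → col u ≡ col u′ → rank u ≡ rank u′ → u ≡ u′
    rank-injective {u} {u′} same-col same-rank with rank-unique (col u) (rank u) (rank< u)
    ... | _ , _ , unique = trans (unique u (refl , refl)) (sym (unique u′ (sym same-col , sym same-rank)))

    label-unique : ∀ c b {t} → t < classSize c → ExactlyOne (λ v → col v ≡ c × label c (rank v) b ≡ t)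
    label-unique c b t<s with +[mod]-solvableˡ b t<s
    ... | a , a<s , a+b≡t with rank-unique c a a<s
    ... | v , (col≡c , rank≡a) , unique =
      v , (col≡c , trans (cong (λ r → label c r b) rank≡a) a+b≡t) ,
      λ u (col≡c′ , label≡t) → unique u (col≡c′ ,
        +[mod]-cancelʳ b (rank<-of col≡c′) a<s (trans label≡t (sym a+b≡t)))

    partner-label-unique : ∀ {c d} → matched c d ≡ true → ∀ b {t} → t < classSize c →
      ExactlyOne (λ v → col v ≡ d × label c (rank (partner c v)) b ≡ t)
    partner-label-unique {c} {d} m b t<s with label-unique c b t<s
    ... | u , (col≡c , label≡t) , unique-u with partner-unique m col≡c
    ... | v , (col≡d , partner≡u) , unique-v =
      v , (col≡d , trans (cong (λ u → label c (rank u) b) partner≡u) label≡t) ,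
      λ v′ (col≡d′ , label≡t′) → unique-v v′ (col≡d′ , unique-u _ (partner-col m col≡d′ , label≡t′))

  -- y p q is the weighted number of averaged maps containing both p and q. ℓ c v w is the label t of the
  -- bijection of class c containing (v , w); for classes c < d, yCross lets the bijection of class c with
  -- label t go together with the bijection of class d whose label is t read through the matching, whose
  -- label is t (equal sizes), or with every bijection of class d (different sizes).
  module Pair {G H : Graph} (S₁ : Side G) (S₂ : Side H) where
    open Side S₁ using () renaming (col to col₁; rank to rank₁; partner to partner₁)
    open Side S₂ using () renaming (col to col₂; rank to rank₂; partner to partner₂)
    module S₁ = Side S₁
    module S₂ = Side S₂

    aligned? : ∀ v w → Dec (col₁ v ≡ col₂ w)
    aligned? v w = col₁ v F.≟ col₂ w

    ℓ : Fin k → V G → V H → ℕ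
    ℓ c v w = label c (rank₁ v) (rank₂ w)

    ℓ< : ∀ {c} v w → 0 < classSize c → ℓ c v w < classSize c
    ℓ< v w = +[mod]-< (rank₁ v) (rank₂ w)

    ℓ-recolour : ∀ {c d} → c ≡ d → ∀ {v v′ w w′} → ℓ c v w ≡ ℓ c v′ w′ → ℓ d v w ≡ ℓ d v′ w′
    ℓ-recolour refl eq = eq

    coupling : ∀ c d → Bool → Dec (classSize c ≡ classSize d) → V G → V H → V G → V H → ℤ
    coupling c d true  _       v w v′ w′ = when (ℓ c v w ℕ.≟ ℓ c (partner₁ c v′) (partner₂ c w′)) (weight c)
    coupling c d false (yes _) v w v′ w′ = when (ℓ c v w ℕ.≟ ℓ d v′ w′) (weight c)
    coupling c d false (no _)  _ _ _  _  = weight₂ c d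

    couplingOf : Fin k → Fin k → V G → V H → V G → V H → ℤ
    couplingOf c d = coupling c d (matched c d) (classSize c ℕ.≟ classSize d)

    same? : ∀ v w v′ w′ → Dec (col₁ v ≡ col₂ w × col₁ v′ ≡ col₂ w′ × col₁ v ≡ col₁ v′ ×
                                ℓ (col₁ v) v w ≡ ℓ (col₁ v) v′ w′)
    same? v w v′ w′ =
      aligned? v w ×-dec aligned? v′ w′ ×-dec col₁ v F.≟ col₁ v′ ×-dec ℓ (col₁ v) v w ℕ.≟ ℓ (col₁ v) v′ w′

    cross? : ∀ v w v′ w′ → Dec (col₁ v ≡ col₂ w × col₁ v′ ≡ col₂ w′ × col₁ v F.< col₁ v′)
    cross? v w v′ w′ = aligned? v w ×-dec aligned? v′ w′ ×-dec col₁ v F.<? col₁ v′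

    ySame : V G → V H → V G → V H → ℤ
    ySame v w v′ w′ = when (same? v w v′ w′) (weight (col₁ v))

    yCross : V G → V H → V G → V H → ℤ
    yCross v w v′ w′ = when (cross? v w v′ w′) (couplingOf (col₁ v) (col₁ v′) v w v′ w′)

    x : Var G H → ℤ
    x (v , w) = when (aligned? v w) (weight (col₁ v))

    y : Var G H → Var G H → ℤ
    y (v , w) (v′ , w′) = ySame v w v′ w′ + (yCross v w v′ w′ + yCross v′ w′ v w)

    x-sumᴳ : ∀ w → sum (λ v → x (v , w)) ≡ + N
    x-sumᴳ w = begin
      sum (λ v → x (v , w))                                  ≡⟨ sum-cong-≗ recolour ⟩
      sum (λ v → when (col₁ v F.≟ col₂ w) (weight (col₂ w))) ≡⟨ S₁.sum-class (col₂ w) (weight (col₂ w)) ⟩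
      weight (col₂ w) * + classSize (col₂ w)                 ≡⟨ share-* nonzero (size∣N (col₂ w) nonzero) ⟩
      + N                                                    ∎
      where
      open ≡-Reasoning
      nonzero = S₂.classSize-nonzero w
      recolour : ∀ v → x (v , w) ≡ when (col₁ v F.≟ col₂ w) (weight (col₂ w))
      recolour v = when-cong (aligned? v w) (col₁ v F.≟ col₂ w) (λ a → a) (λ a → a) (cong weight)

    yCross-diag : ∀ v w → yCross v w v w ≡ + 0
    yCross-diag v w = when-no (cross? v w v w) λ (_ , _ , c<c) → FP.<-irrefl refl c<c

    y-diag : ∀ p → y p p ≡ x p
    y-diag (v , w) = begin
      ySame v w v w + (yCross v w v w + yCross v w v w) ≡⟨ cong (λ z → ySame v w v w + (z + z)) (yCross-diag v w) ⟩
      ySame v w v w + + 0                              ≡⟨ ℤP.+-identityʳ _ ⟩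
      ySame v w v w                                    ≡⟨ when-cong (same? v w v w) (aligned? v w)
                                                            proj₁ (λ a → a , a , refl , refl) (λ _ → refl) ⟩
      x (v , w)                                        ∎
      where open ≡-Reasoning

    ySame-sym : ∀ v w v′ w′ → ySame v w v′ w′ ≡ ySame v′ w′ v w
    ySame-sym v w v′ w′ = when-cong (same? v w v′ w′) (same? v′ w′ v w)
      (λ (a , a′ , same , labels) → a′ , a , sym same , ℓ-recolour same (sym labels))
      (λ (a′ , a , same , labels) → a , a′ , sym same , ℓ-recolour same (sym labels))
      (λ (_ , _ , same , _) → cong weight same)

    y-sym : ∀ p q → y p q ≡ y q p
    y-sym (v , w) (v′ , w′) = cong₂ _+_ (ySame-sym v w v′ w′) (ℤP.+-comm (yCross v w v′ w′) (yCross v′ w′ v w))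

    sum-select : ∀ c {P : V G → Set} (P? : ∀ v → Dec (P v)) {z} → ExactlyOne (λ v → col₁ v ≡ c × P v) →
                 sum (λ v → when (col₁ v F.≟ c) (when (P? v) z)) ≡ z
    sum-select c P? unique = trans (sum-cong-≗ (λ v → when-when (col₁ v F.≟ c) (P? v)))
                                   (sum-when-unique (λ v → col₁ v F.≟ c ×-dec P? v) unique)

    module _ (w : V H) (v′ : V G) (w′ : V H) (aligned′ : col₁ v′ ≡ col₂ w′) where
      private
        c = col₂ w
        d = col₁ v′

      sum-ySame-≡ : c ≡ d → sum (λ v → ySame v w v′ w′) ≡ weight d
      sum-ySame-≡ c≡d = sum-unique (λ v → ySame v w v′ w′)
        (S₁.label-unique d (rank₂ w) (ℓ< v′ w′ (S₁.classSize-pos v′)))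
        (λ v (col≡d , labels) → trans (when-yes (same? v w v′ w′)
                                         (trans col≡d (sym c≡d) , aligned′ , col≡d , ℓ-recolour (sym col≡d) labels))
                                      (cong weight col≡d))
        (λ v ¬P → when-no (same? v w v′ w′) λ (_ , _ , col≡d , labels) → ¬P (col≡d , ℓ-recolour col≡d labels))

      sum-ySame-≢ : c ≢ d → sum (λ v → ySame v w v′ w′) ≡ + 0
      sum-ySame-≢ c≢d = sum-zero _ λ v →
        when-no (same? v w v′ w′) λ (aligned , _ , col≡d , _) → c≢d (trans (sym aligned) col≡d)

      sum-yCross-< : c F.< d → sum (λ v → yCross v w v′ w′) ≡ weight d
      sum-yCross-< c<d = trans (sum-cong-≗ restrict) (sum-coupling (matched c d) refl (classSize c ℕ.≟ classSize d))
        where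
        restrict : ∀ v → yCross v w v′ w′ ≡ when (col₁ v F.≟ c) (couplingOf c d v w v′ w′)
        restrict v = when-cong (cross? v w v′ w′) (col₁ v F.≟ c) proj₁
          (λ col≡c → col≡c , aligned′ , subst (F._< d) (sym col≡c) c<d)
          (λ (col≡c , _) → cong (λ c → couplingOf c d v w v′ w′) col≡c)
        sum-coupling : ∀ b → matched c d ≡ b → ∀ sizes? →
                       sum (λ v → when (col₁ v F.≟ c) (coupling c d b sizes? v w v′ w′)) ≡ weight d
        sum-coupling true m _ = trans
          (sum-select c (λ v → ℓ c v w ℕ.≟ ℓ c (partner₁ c v′) (partner₂ c w′))
             (S₁.label-unique c (rank₂ w) (ℓ< (partner₁ c v′) (partner₂ c w′) (S₂.classSize-pos w))))
          (cong share (matched-size m))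
        sum-coupling false _ (yes same-size) = trans
          (sum-select c (λ v → ℓ c v w ℕ.≟ ℓ d v′ w′)
             (S₁.label-unique c (rank₂ w) (subst (ℓ d v′ w′ <_) (sym same-size) (ℓ< v′ w′ (S₁.classSize-pos v′)))))
          (cong share same-size)
        sum-coupling false _ (no different-size) = trans (S₁.sum-class c (weight₂ c d))
          (share-cancel c≢0 d≢0 (size*size∣N c d c≢0 d≢0 different-size) (size∣N d d≢0))
          where
          c≢0 = S₂.classSize-nonzero w
          d≢0 = S₁.classSize-nonzero v′

      sum-yCross-≮ : ¬ (c F.< d) → sum (λ v → yCross v w v′ w′) ≡ + 0
      sum-yCross-≮ c≮d = sum-zero _ λ v →
        when-no (cross? v w v′ w′) λ (aligned , _ , lt) → c≮d (subst (F._< d) aligned lt)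

      sum-yCross-> : d F.< c → sum (λ v → yCross v′ w′ v w) ≡ weight d
      sum-yCross-> d<c = trans (sum-cong-≗ restrict) (sum-coupling (matched d c) refl (classSize d ℕ.≟ classSize c))
        where
        restrict : ∀ v → yCross v′ w′ v w ≡ when (col₁ v F.≟ c) (couplingOf d c v′ w′ v w)
        restrict v = when-cong (cross? v′ w′ v w) (col₁ v F.≟ c) (proj₁ ∘ proj₂)
          (λ col≡c → aligned′ , col≡c , subst (d F.<_) (sym col≡c) d<c)
          (λ (_ , col≡c , _) → cong (λ c → couplingOf d c v′ w′ v w) col≡c)
        t<d : ℓ d v′ w′ < classSize d
        t<d = ℓ< v′ w′ (S₁.classSize-pos v′)
        sum-coupling : ∀ b → matched d c ≡ b → ∀ sizes? →
                       sum (λ v → when (col₁ v F.≟ c) (coupling d c b sizes? v′ w′ v w)) ≡ weight d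
        sum-coupling true m _ =
          sum-select c (λ v → ℓ d v′ w′ ℕ.≟ ℓ d (partner₁ d v) (partner₂ d w))
            (exactlyOne-sym (S₁.partner-label-unique m (rank₂ (partner₂ d w)) t<d))
        sum-coupling false _ (yes same-size) =
          sum-select c (λ v → ℓ d v′ w′ ℕ.≟ ℓ c v w)
            (exactlyOne-sym (S₁.label-unique c (rank₂ w) (subst (ℓ d v′ w′ <_) same-size t<d)))
        sum-coupling false _ (no different-size) = begin
          sum (λ v → when (col₁ v F.≟ c) (weight₂ d c)) ≡⟨ S₁.sum-class c (weight₂ d c) ⟩
          weight₂ d c * + classSize c                  ≡⟨ cong (λ m → share m * + classSize c)
                                                                 (NP.*-comm (classSize d) (classSize c)) ⟩
          weight₂ c d * + classSize c                  ≡⟨ share-cancel c≢0 d≢0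
                                                            (size*size∣N c d c≢0 d≢0 (different-size ∘ sym))
                                                            (size∣N d d≢0) ⟩
          weight d                                     ∎
          where
          open ≡-Reasoning
          c≢0 = S₂.classSize-nonzero w
          d≢0 = S₁.classSize-nonzero v′

      sum-yCross-≯ : ¬ (d F.< c) → sum (λ v → yCross v′ w′ v w) ≡ + 0
      sum-yCross-≯ d≮c = sum-zero _ λ v →
        when-no (cross? v′ w′ v w) λ (_ , aligned , lt) → d≮c (subst (d F.<_) aligned lt)

      sum-y-aligned : sum (λ v → y (v , w) (v′ , w′)) ≡ weight d
      sum-y-aligned = trans split (by-trichotomy (FP.<-cmp c d))
        where
        split : sum (λ v → y (v , w) (v′ , w′)) ≡
                sum (λ v → ySame v w v′ w′) + (sum (λ v → yCross v w v′ w′) + sum (λ v → yCross v′ w′ v w))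
        split = trans (∑-distrib-+ (λ v → ySame v w v′ w′) (λ v → yCross v w v′ w′ + yCross v′ w′ v w))
                      (cong (λ z → sum (λ v → ySame v w v′ w′) + z)
                            (∑-distrib-+ (λ v → yCross v w v′ w′) (λ v → yCross v′ w′ v w)))
        by-trichotomy : Tri (c F.< d) (c ≡ d) (d F.< c) →
          sum (λ v → ySame v w v′ w′) + (sum (λ v → yCross v w v′ w′) + sum (λ v → yCross v′ w′ v w)) ≡ weight d
        by-trichotomy (tri< c<d c≢d d≮c) rewrite sum-ySame-≢ c≢d | sum-yCross-< c<d | sum-yCross-≯ d≮c =
          trans (ℤP.+-identityˡ _) (ℤP.+-identityʳ _)
        by-trichotomy (tri≈ c≮d c≡d d≮c) rewrite sum-ySame-≡ c≡d | sum-yCross-≮ c≮d | sum-yCross-≯ d≮c =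
          ℤP.+-identityʳ _
        by-trichotomy (tri> c≮d c≢d d<c) rewrite sum-ySame-≢ c≢d | sum-yCross-≮ c≮d | sum-yCross-> d<c =
          trans (ℤP.+-identityˡ _) (ℤP.+-identityˡ _)

    y-sumᴳ : ∀ w q → sum (λ v → y (v , w) q) ≡ x q
    y-sumᴳ w (v′ , w′) = by-alignment (aligned? v′ w′)
      where
      by-alignment : Dec (col₁ v′ ≡ col₂ w′) → sum (λ v → y (v , w) (v′ , w′)) ≡ x (v′ , w′)
      by-alignment (yes aligned′) = trans (sum-y-aligned w v′ w′ aligned′) (sym (when-yes (aligned? v′ w′) aligned′))
      by-alignment (no misaligned′) = trans (sum-zero _ vanishes) (sym (when-no (aligned? v′ w′) misaligned′))
        where
        vanishes : ∀ v → y (v , w) (v′ , w′) ≡ + 0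
        vanishes v = cong₂ _+_ (when-no (same? v w v′ w′) (misaligned′ ∘ proj₁ ∘ proj₂))
                               (cong₂ _+_ (when-no (cross? v w v′ w′) (misaligned′ ∘ proj₁ ∘ proj₂))
                                          (when-no (cross? v′ w′ v w) (misaligned′ ∘ proj₁)))

    ySame-nonIso : ∀ v w v′ w′ → ¬ IsLocalIso G H ((v , w) ∷ (v′ , w′) ∷ []) → ySame v w v′ w′ ≡ + 0
    ySame-nonIso v w v′ w′ ¬iso = when-≡0 (same? v w v′ w′) λ (aligned , aligned′ , same , labels) →
      let sameᴴ = trans (sym aligned) (trans same aligned′) in
      ⊥-elim (¬iso (pair-isLocalIso G H
        (λ { refl → S₂.rank-injective sameᴴ
                      (+[mod]-cancelˡ (rank₁ v) (S₂.rank<-of (sym aligned))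
                                      (S₂.rank<-of (trans (sym aligned′) (sym same))) labels) })
        (λ { refl → S₁.rank-injective same
                      (+[mod]-cancelʳ (rank₂ w) (S₁.rank< v) (S₁.rank<-of (sym same)) labels) })
        (⊥-elim ∘ S₁.independent v v′ same)
        (⊥-elim ∘ S₂.independent w w′ sameᴴ)))

    module _ {c d v w v′ w′} (m : matched c d ≡ true) (cv : col₁ v ≡ c) (cw : col₂ w ≡ c)
             (dv′ : col₁ v′ ≡ d) (dw′ : col₂ w′ ≡ d)
             (labels : ℓ c v w ≡ ℓ c (partner₁ c v′) (partner₂ c w′)) where

      partner-transferᴳ : v ≡ partner₁ c v′ → w ≡ partner₂ c w′
      partner-transferᴳ refl = S₂.rank-injective (trans cw (sym (S₂.partner-col m dw′)))
        (+[mod]-cancelˡ (rank₁ v) (S₂.rank<-of cw) (S₂.rank<-of (S₂.partner-col m dw′)) labels)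

      partner-transferᴴ : w ≡ partner₂ c w′ → v ≡ partner₁ c v′
      partner-transferᴴ refl = S₁.rank-injective (trans cv (sym (S₁.partner-col m dv′)))
        (+[mod]-cancelʳ (rank₂ w) (S₁.rank<-of cv) (S₁.rank<-of (S₁.partner-col m dv′)) labels)

      matched-isLocalIso : c ≢ d → IsLocalIso G H ((v , w) ∷ (v′ , w′) ∷ [])
      matched-isLocalIso c≢d = pair-isLocalIso G H
        (λ v≡v′ → ⊥-elim (c≢d (trans (sym cv) (trans (cong col₁ v≡v′) dv′))))
        (λ w≡w′ → ⊥-elim (c≢d (trans (sym cw) (trans (cong col₂ w≡w′) dw′))))
        (λ e → subst (λ u → E H u w′) (sym (partner-transferᴳ (S₁.edge-partner m cv dv′ e))) (S₂.partner-edge m dw′))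
        (λ e → subst (λ u → E G u v′) (sym (partner-transferᴴ (S₂.edge-partner m cw dw′ e))) (S₁.partner-edge m dv′))

    yCross-nonIso : ∀ v w v′ w′ → ¬ IsLocalIso G H ((v , w) ∷ (v′ , w′) ∷ []) → yCross v w v′ w′ ≡ + 0
    yCross-nonIso v w v′ w′ ¬iso = when-≡0 (cross? v w v′ w′) λ (aligned , aligned′ , c<d) →
      coupling-nonIso aligned aligned′ c<d (matched c d) refl (classSize c ℕ.≟ classSize d)
      where
      c = col₁ v
      d = col₁ v′
      coupling-nonIso : c ≡ col₂ w → d ≡ col₂ w′ → c F.< d → ∀ b → matched c d ≡ b → ∀ sizes? →
                        coupling c d b sizes? v w v′ w′ ≡ + 0
      coupling-nonIso aligned aligned′ c<d true m _ =
        when-≡0 (ℓ c v w ℕ.≟ ℓ c (partner₁ c v′) (partner₂ c w′)) λ labels →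
          ⊥-elim (¬iso (matched-isLocalIso m refl (sym aligned) refl (sym aligned′) labels (FP.<⇒≢ c<d)))
      coupling-nonIso aligned aligned′ c<d false m _ = ⊥-elim (¬iso (pair-isLocalIso G H
        (λ v≡v′ → ⊥-elim (FP.<⇒≢ c<d (cong col₁ v≡v′)))
        (λ w≡w′ → ⊥-elim (FP.<⇒≢ c<d (trans aligned (trans (cong col₂ w≡w′) (sym aligned′)))))
        (⊥-elim ∘ S₁.unmatched-noEdges c<d m v v′ refl refl)
        (⊥-elim ∘ S₂.unmatched-noEdges c<d m w w′ (sym aligned) (sym aligned′))))

    y-nonIso : ∀ p q → ¬ IsLocalIso G H (p ∷ q ∷ []) → y p q ≡ + 0
    y-nonIso (v , w) (v′ , w′) ¬iso =
      cong₂ _+_ (ySame-nonIso v w v′ w′ ¬iso)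
                (cong₂ _+_ (yCross-nonIso v w v′ w′ ¬iso) (yCross-nonIso v′ w′ v w (¬iso ∘ isLocalIso-swap G H)))

  module Solution {G H : Graph} (S₁ : Side G) (S₂ : Side H) where
    private
      module A = Pair S₁ S₂
      module B = Pair S₂ S₁
    open Side S₁ using () renaming (col to col₁; rank to rank₁; partner to partner₁)
    open Side S₂ using () renaming (col to col₂; rank to rank₂; partner to partner₂)

    ℓ-swap : ∀ c v w → B.ℓ c w v ≡ A.ℓ c v w
    ℓ-swap c v w = +[mod]-comm (classSize c) (rank₂ w) (rank₁ v)

    x-swap : ∀ v w → B.x (w , v) ≡ A.x (v , w)
    x-swap v w = when-cong (B.aligned? w v) (A.aligned? v w) sym sym (cong weight)

    ySame-swap : ∀ v w v′ w′ → B.ySame w v w′ v′ ≡ A.ySame v w v′ w′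
    ySame-swap v w v′ w′ = when-cong (B.same? w v w′ v′) (A.same? v w v′ w′)
      (λ (a , a′ , same , labels) → sym a , sym a′ , trans (sym a) (trans same a′) ,
         A.ℓ-recolour a (trans (sym (ℓ-swap _ v w)) (trans labels (ℓ-swap _ v′ w′))))
      (λ (a , a′ , same , labels) → sym a , sym a′ , trans (sym a) (trans same a′) ,
         B.ℓ-recolour a (trans (ℓ-swap _ v w) (trans labels (sym (ℓ-swap _ v′ w′)))))
      (λ (a , _) → cong weight a)

    coupling-swap : ∀ c d b sizes? v w v′ w′ → B.coupling c d b sizes? w v w′ v′ ≡ A.coupling c d b sizes? v w v′ w′
    coupling-swap c d true  _       v w v′ w′ =
      cong₂ (λ l l′ → when (l ℕ.≟ l′) (weight c)) (ℓ-swap c v w) (ℓ-swap c (partner₁ c v′) (partner₂ c w′))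
    coupling-swap c d false (yes _) v w v′ w′ =
      cong₂ (λ l l′ → when (l ℕ.≟ l′) (weight c)) (ℓ-swap c v w) (ℓ-swap d v′ w′)
    coupling-swap c d false (no _)  _ _ _  _  = refl

    couplingOf-swap : ∀ c d v w v′ w′ → B.couplingOf c d w v w′ v′ ≡ A.couplingOf c d v w v′ w′
    couplingOf-swap c d = coupling-swap c d (matched c d) (classSize c ℕ.≟ classSize d)

    yCross-swap : ∀ v w v′ w′ → B.yCross w v w′ v′ ≡ A.yCross v w v′ w′
    yCross-swap v w v′ w′ = when-cong (B.cross? w v w′ v′) (A.cross? v w v′ w′)
      (λ (a , a′ , lt) → sym a , sym a′ , subst₂ F._<_ a a′ lt)
      (λ (a , a′ , lt) → sym a , sym a′ , subst₂ F._<_ a a′ lt)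
      (λ (a , a′ , _) → trans (cong₂ (λ c d → B.couplingOf c d w v w′ v′) a a′)
                              (couplingOf-swap (col₁ v) (col₁ v′) v w v′ w′))

    y-swap : ∀ v w v′ w′ → B.y (w , v) (w′ , v′) ≡ A.y (v , w) (v′ , w′)
    y-swap v w v′ w′ = cong₂ _+_ (ySame-swap v w v′ w′) (cong₂ _+_ (yCross-swap v w v′ w′) (yCross-swap v′ w′ v w))

    solution : QuadraticSolution G H (+ N)
    solution = record
      { x        = A.x
      ; y        = A.y
      ; y-sym    = A.y-sym
      ; y-diag   = A.y-diag
      ; x-sumᴳ   = A.x-sumᴳ
      ; x-sumᴴ   = λ v → trans (sum-cong-≗ (λ w → sym (x-swap v w))) (B.x-sumᴳ v)
      ; y-sumᴳ   = A.y-sumᴳ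
      ; y-sumᴴ   = λ { v (v′ , w′) → trans (sum-cong-≗ (λ w → sym (y-swap v w v′ w′)))
                                           (trans (B.y-sumᴳ v (w′ , v′)) (x-swap v′ w′)) }
      ; y-nonIso = A.y-nonIso
      }

module FromSuitable {G H : Graph} {k : ℕ} {colᴳ : V G → Fin k} {colᴴ : V H → Fin k}
                    (suitable : Suitable G H k colᴳ colᴴ) where
  open Suitable suitable

  isMatching : ∀ {c d} → (NoEdges G colᴳ c d × NoEdges H colᴴ c d) ⊎ (Matching G colᴳ c d × Matching H colᴴ c d) → Bool
  isMatching (inj₁ _) = false
  isMatching (inj₂ _) = true

  matchedIf : ∀ c d → Dec (c F.< d) → Bool
  matchedIf c d (yes c<d) = isMatching (shape c d (FP.<⇒≢ c<d))
  matchedIf c d (no _)    = false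

  matched : Fin k → Fin k → Bool
  matched c d = matchedIf c d (c F.<? d)

  matched⇒Matching : ∀ {c d} → matched c d ≡ true → Matching G colᴳ c d × Matching H colᴴ c d
  matched⇒Matching {c} {d} = from (c F.<? d)
    where
    from-shape : ∀ s → isMatching s ≡ true → Matching G colᴳ c d × Matching H colᴴ c d
    from-shape (inj₂ matchings) _ = matchings
    from : ∀ c<d? → matchedIf c d c<d? ≡ true → Matching G colᴳ c d × Matching H colᴴ c d
    from (yes c<d) = from-shape (shape c d (FP.<⇒≢ c<d))

  unmatched⇒NoEdges : ∀ {c d} → c F.< d → matched c d ≡ false → NoEdges G colᴳ c d × NoEdges H colᴴ c d
  unmatched⇒NoEdges {c} {d} c<d = from (c F.<? d)
    where
    from-shape : ∀ s → isMatching s ≡ false → NoEdges G colᴳ c d × NoEdges H colᴴ c d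
    from-shape (inj₁ noEdges) _ = noEdges
    from : ∀ c<d? → matchedIf c d c<d? ≡ false → NoEdges G colᴳ c d × NoEdges H colᴴ c d
    from (yes c<d) = from-shape (shape c d (FP.<⇒≢ c<d))
    from (no c≮d)  = ⊥-elim (c≮d c<d)

  module Partner (Γ : Graph) (col : V Γ → Fin k)
                 (matching : ∀ {c d} → matched c d ≡ true → Matching Γ col c d) where

    -- the unique neighbour of colour c of v (v itself when the classes c and col v are not matched)
    partnerIf : ∀ c v b → (b ≡ true → Matching Γ col c (col v)) → V Γ
    partnerIf c v true  M = proj₁ (proj₂ (M refl) v refl)
    partnerIf c v false _ = v

    partner : Fin k → V Γ → V Γ
    partner c v = partnerIf c v (matched c (col v)) matching

    PartnerSpec : Fin k → V Γ → V Γ → Set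
    PartnerSpec c v u = col u ≡ c × E Γ u v × (∀ u′ → col u′ ≡ c → E Γ u′ v → u′ ≡ u)

    partnerIf-spec : ∀ c v b M → b ≡ true → PartnerSpec c v (partnerIf c v b M)
    partnerIf-spec c v true M _ with proj₂ (M refl) v refl
    ... | _ , (col≡c , edge) , unique = col≡c , edge , λ u′ col≡c′ edge′ → unique u′ (col≡c′ , edge′)

    partner-spec : ∀ {c d v} → matched c d ≡ true → col v ≡ d → PartnerSpec c v (partner c v)
    partner-spec {c} {v = v} m refl = partnerIf-spec c v (matched c (col v)) matching m

    partner-unique : ∀ {c d u} → matched c d ≡ true → col u ≡ c →
                     ExactlyOne (λ v → col v ≡ d × partner c v ≡ u)
    partner-unique m col≡c with proj₁ (matching m) _ col≡c
    ... | v , (col≡d , edge) , unique =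
      v , (col≡d , sym (proj₂ (proj₂ (partner-spec m col≡d)) _ col≡c edge)) ,
      λ v′ (col≡d′ , partner≡u) →
        unique v′ (col≡d′ , subst (λ u → E Γ u v′) partner≡u (proj₁ (proj₂ (partner-spec m col≡d′))))

    matched-count : ∀ {c d} → matched c d ≡ true → count col c ≡ count col d
    matched-count {c} {d} m = ℤP.+-injective (begin
      + count col c                                     ≡⟨ sum-indicator c ⟨
      sum (λ u → when (col u F.≟ c) (+ 1))              ≡⟨ sum-cong-≗ by-partner ⟩
      sum (λ u → sum (λ v → when (pairs? v u) (+ 1)))   ≡⟨ ∑-comm (λ u v → when (pairs? v u) (+ 1)) ⟩
      sum (λ v → sum (λ u → when (pairs? v u) (+ 1)))   ≡⟨ sum-cong-≗ by-vertex ⟩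
      sum (λ v → when (col v F.≟ d) (+ 1))              ≡⟨ sum-indicator d ⟩
      + count col d                                     ∎)
      where
      open ≡-Reasoning
      sum-indicator : ∀ e → sum (λ u → when (col u F.≟ e) (+ 1)) ≡ + count col e
      sum-indicator e = trans (sum-when-tabulate (λ u → col u F.≟ e) (λ u → u) (+ 1)) (ℤP.*-identityˡ _)
      pairs? : ∀ v u → Dec (col v ≡ d × partner c v ≡ u)
      pairs? v u = col v F.≟ d ×-dec partner c v F.≟ u
      by-partner : ∀ u → when (col u F.≟ c) (+ 1) ≡ sum (λ v → when (pairs? v u) (+ 1))
      by-partner u = by-colour (col u F.≟ c)
        where
        by-colour : Dec (col u ≡ c) → when (col u F.≟ c) (+ 1) ≡ sum (λ v → when (pairs? v u) (+ 1))
        by-colour (yes col≡c) = trans (when-yes (col u F.≟ c) col≡c)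
                                      (sym (sum-when-unique (λ v → pairs? v u) (partner-unique m col≡c)))
        by-colour (no col≢c)  = trans (when-no (col u F.≟ c) col≢c) (sym (sum-zero _ λ v →
          when-no (pairs? v u) λ (col≡d , partner≡u) →
            col≢c (subst (λ u → col u ≡ c) partner≡u (proj₁ (partner-spec m col≡d)))))
      by-vertex : ∀ v → sum (λ u → when (pairs? v u) (+ 1)) ≡ when (col v F.≟ d) (+ 1)
      by-vertex v = by-colour (col v F.≟ d)
        where
        by-colour : Dec (col v ≡ d) → sum (λ u → when (pairs? v u) (+ 1)) ≡ when (col v F.≟ d) (+ 1)
        by-colour (yes col≡d) = trans (sum-when-unique (pairs? v) (partner c v , (col≡d , refl) , λ u (_ , eq) → sym eq))
                                      (sym (when-yes (col v F.≟ d) col≡d))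
        by-colour (no col≢d)  = trans (sum-zero _ λ u → when-no (pairs? v u) (col≢d ∘ proj₁))
                                      (sym (when-no (col v F.≟ d) col≢d))

  classSize : Fin k → ℕ
  classSize = count colᴳ

  matched-size : ∀ {c d} → matched c d ≡ true → classSize c ≡ classSize d
  matched-size = Partner.matched-count G colᴳ (proj₁ ∘ matched⇒Matching)

  module _ (N : ℕ) (size∣N : ∀ c → classSize c ≢ 0 → classSize c ∣ N)
           (size*size∣N : ∀ c d → classSize c ≢ 0 → classSize d ≢ 0 → classSize c ≢ classSize d →
                          classSize c ℕ.* classSize d ∣ N) where
    open Construction k classSize matched matched-size N size∣N size*size∣N

    side : (Γ : Graph) (col : V Γ → Fin k) → (∀ {c d} → matched c d ≡ true → Matching Γ col c d) →
           (∀ c → count col c ≡ classSize c) → (∀ u v → col u ≡ col v → ¬ E Γ u v) →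
           (∀ {c d} → c F.< d → matched c d ≡ false → NoEdges Γ col c d) → Side Γ
    side Γ col matching count-col independent unmatched-noEdges = record
      { col               = col
      ; rank              = classRank col
      ; partner           = P.partner
      ; count-col         = count-col
      ; rank<             = λ v → subst (classRank col v ℕ.<_) (count-col (col v)) (classRank<count col v)
      ; rank-unique       = λ c r r< → classRank-unique col c r (subst (r ℕ.<_) (sym (count-col c)) r<)
      ; independent       = independent
      ; unmatched-noEdges = unmatched-noEdges
      ; partner-col       = λ m col≡d → proj₁ (P.partner-spec m col≡d)
      ; partner-unique    = P.partner-unique
      ; partner-edge      = λ m col≡d → proj₁ (proj₂ (P.partner-spec m col≡d))
      ; edge-partner      = λ m col≡c col≡d edge → proj₂ (proj₂ (P.partner-spec m col≡d)) _ col≡c edge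
      }
      where module P = Partner Γ col matching

    solution : QuadraticSolution G H (+ N)
    solution = Solution.solution
      (side G colᴳ (proj₁ ∘ matched⇒Matching) (λ _ → refl) indepG (λ c<d m → proj₁ (unmatched⇒NoEdges c<d m)))
      (side H colᴴ (proj₂ ∘ matched⇒Matching) (sym ∘ sameCount) indepH (λ c<d m → proj₂ (unmatched⇒NoEdges c<d m)))

-- Divisibility by the index

*∣product : ∀ {a b} (ns : List ℕ) → a ≢ b → a ∈ ns → b ∈ ns → a ℕ.* b ∣ product ns
*∣product (_ ∷ ns) a≢b (here refl) (here refl) = ⊥-elim (a≢b refl)
*∣product {a} (_ ∷ ns) _ (here refl) (there b∈) = *-monoʳ-∣ a (∈⇒∣product b∈)
*∣product {a} {b} (_ ∷ ns) _ (there a∈) (here refl) =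
  subst (_∣ b ℕ.* product ns) (NP.*-comm b a) (*-monoʳ-∣ b (∈⇒∣product a∈))
*∣product (n ∷ ns) a≢b (there a∈) (there b∈) = ∣n⇒∣m*n n (*∣product ns a≢b a∈ b∈)

module _ {n k : ℕ} (col : Fin n → Fin k) where

  count∈index : ∀ c → count col c ≢ 0 → count col c ∈ deduplicate ℕ._≟_ (classSizes col)
  count∈index c count≢0 =
    ∈-deduplicate⁺ ℕ._≟_ (∈-filter⁺ (λ s → ¬? (s ℕ.≟ 0)) (∈-map⁺ (count col) (∈-allFin c)) count≢0)

  count∣index : ∀ c → count col c ≢ 0 → count col c ∣ index col
  count∣index c count≢0 = ∈⇒∣product (count∈index c count≢0)

  count*count∣index : ∀ c d → count col c ≢ 0 → count col d ≢ 0 → count col c ≢ count col d →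
                      count col c ℕ.* count col d ∣ index col
  count*count∣index c d c≢0 d≢0 c≢d = *∣product _ c≢d (count∈index c c≢0) (count∈index d d≢0)

private
  castℤ : ∀ {a b c d} → 1 ℕ.+ a ℕ.* b ≡ c ℕ.* d → + 1 + + a * + b ≡ + c * + d
  castℤ {a} {b} {c} {d} eq = begin
    + 1 + + a * + b       ≡⟨ cong (λ z → + 1 + z) (ℤP.pos-* a b) ⟨
    + 1 + + (a ℕ.* b)     ≡⟨ ℤP.pos-+ 1 (a ℕ.* b) ⟨
    + (1 ℕ.+ a ℕ.* b)     ≡⟨ cong +_ eq ⟩
    + (c ℕ.* d)           ≡⟨ ℤP.pos-* c d ⟩
    + c * + d             ∎
    where open ≡-Reasoning

  1+z-z≡1 : ∀ z → + 1 + z + - z ≡ + 1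
  1+z-z≡1 = solve-∀

  -z+[1+z]≡1 : ∀ z → - z + (+ 1 + z) ≡ + 1
  -z+[1+z]≡1 = solve-∀

bézoutℤ : ∀ {m n} → Bézout.Identity 1 m n → Σ ℤ λ α → Σ ℤ λ β → α * + m + β * + n ≡ + 1
bézoutℤ {m} {n} (Bézout.+- x y eq) = + x , - + y ,
  trans (cong₂ _+_ (sym (castℤ {y} {n} {x} {m} eq)) (sym (ℤP.neg-distribˡ-* (+ y) (+ n))))
        (1+z-z≡1 (+ y * + n))
bézoutℤ {m} {n} (Bézout.-+ x y eq) = - + x , + y ,
  trans (cong₂ _+_ (sym (ℤP.neg-distribˡ-* (+ x) (+ m))) (sym (castℤ {x} {m} {y} {n} eq)))
        (-z+[1+z]≡1 (+ x * + m))

lemma9 : (G H : Graph) → (2 ≤ size G ⊎ 2 ≤ size H) →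
    (k₁ k₂ : ℕ) →
    (c₁G : V G → Fin k₁) (c₁H : V H → Fin k₁) →
    (c₂G : V G → Fin k₂) (c₂H : V H → Fin k₂) →
    Suitable G H k₁ c₁G c₁H → Suitable G H k₂ c₂G c₂H →
    Coprime (index c₁G) (index c₂G) →
    MLINSolvableℤ (Piso G H ^[ 2 ])
lemma9 G H _ k₁ k₂ c₁G c₁H c₂G c₂H suitable₁ suitable₂ coprime =
  let α , β , α*m+β*n≡1 = bézoutℤ (coprime-Bézout coprime) in
  mlinSolvable (subst (QuadraticSolution G H) α*m+β*n≡1 (lincomb solution₁ solution₂ α β))
  where
  solution₁ : QuadraticSolution G H (+ index c₁G)
  solution₁ = FromSuitable.solution suitable₁ (index c₁G) (count∣index c₁G) (count*count∣index c₁G)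
  solution₂ : QuadraticSolution G H (+ index c₂G)
  solution₂ = FromSuitable.solution suitable₂ (index c₂G) (count∣index c₂G) (count*count∣index c₂G)
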